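{- Suppose $\{W_1,\ldots,W_f\}$ is a set of mutually quasi-unbiased weighing matrices for parameters $(d,k,l,a)$. Then $\{\frac{1}{\sqrt a}W_2W_1^T,\ldots,\frac{1}{\sqrt a}W_fW_1^T\}$ is a set of mutually unbiased weighing matrices of weight $l$.
   Context: A weighing matrix of order $d$ and weight $k$ is a $d\times d$ matrix $W$ with entries in $\{0,\pm1\}$ with $WW^T=kI$. Two weighing matrices $W_1,W_2$ of order $d$ and weight $k$ are quasi-unbiased for parameters $(d,k,l,a)$ (with $a,l$ positive integers) if $\frac{1}{\sqrt a}W_1W_2^T$ is a weighing matrix of weight $l$ (so $l=k^2/a$). A set is mutually quasi-unbiased for $(d,k,l,a)$ if any two distinct members are quasi-unbiased for $(d,k,l,a)$. Two weighing matrices $V_1,V_2$ of weight $l$ are unbiased if $\frac{1}{\sqrt l}V_1V_2^T$ is a weighing matrix of weight $l$; a set is mutually unbiased if any two distinct members are unbiased. -}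

module Defs where

open import Data.Nat using (ℕ; suc)
open import Data.Fin using (Fin; zero; suc; _≟_)
open import Data.Integer using (ℤ; +_; -[1+_]; _+_; _*_; 0ℤ; 1ℤ; -1ℤ)
open import Data.Product using (Σ; ∃; _×_; _,_)
open import Data.Sum using (_⊎_)
open import Relation.Binary.PropositionalEquality using (_≡_; _≢_)
open import Relation.Nullary using (yes; no)

Mat : ℕ → Set
Mat d = Fin d → Fin d → ℤ

sumFin : ∀ {n} → (Fin n → ℤ) → ℤ
sumFin {ℕ.zero} f = 0ℤ
sumFin {suc n} f = f zero + sumFin (λ i → f (suc i))

transpose : ∀ {d} → Mat d → Mat d
transpose M i j = M j i

_·_ : ∀ {d} → Mat d → Mat d → Mat d
(A · B) i j = sumFin (λ t → A i t * B t j)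

_⊙_ : ∀ {d} → ℤ → Mat d → Mat d
(c ⊙ M) i j = c * M i j

scalarI : ∀ {d} → ℤ → Mat d
scalarI c i j with i ≟ j
... | yes _ = c
... | no _ = 0ℤ

Trit : ℤ → Set
Trit x = (x ≡ 0ℤ ⊎ x ≡ 1ℤ) ⊎ x ≡ -1ℤ

IsWeighing : (d k : ℕ) → Mat d → Set
IsWeighing d k W = (∀ i j → Trit (W i j)) × (∀ i j → (W · transpose W) i j ≡ scalarI (+ k) i j)

-- "(1/√c) M = V", i.e. M = √c · V, for integer matrices: √c realised by a
-- natural number r with r² = c and M = r V.
IsScaledBy : ∀ {d} → ℕ → Mat d → Mat d → Set
IsScaledBy c M V = Σ ℕ λ r → (r ℕ.* r ≡ c) × (∀ i j → M i j ≡ (+ r) * V i j)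
  where import Data.Nat as ℕ

QuasiUnbiased : (d k l a : ℕ) → Mat d → Mat d → Set
QuasiUnbiased d k l a W₁ W₂ =
  Σ (Mat d) λ V → IsScaledBy a (W₁ · transpose W₂) V × IsWeighing d l V

MutuallyQuasiUnbiased : (d k l a f : ℕ) → (Fin f → Mat d) → Set
MutuallyQuasiUnbiased d k l a f W =
  (∀ i → IsWeighing d k (W i)) × (∀ i j → i ≢ j → QuasiUnbiased d k l a (W i) (W j))

Unbiased : (d l : ℕ) → Mat d → Mat d → Set
Unbiased d l V₁ V₂ =
  Σ (Mat d) λ U → IsScaledBy l (V₁ · transpose V₂) U × IsWeighing d l U

MutuallyUnbiased : (d l m : ℕ) → (Fin m → Mat d) → Set
MutuallyUnbiased d l m V =
  (∀ i → IsWeighing d l (V i)) × (∀ i j → i ≢ j → Unbiased d l (V i) (V j))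

module Submission where

-- Each Vⱼ is the weighing matrix witnessing that Wⱼ₊₁ and W₀ are quasi-unbiased,
-- since (1/√a)-rescaling determines a matrix uniquely.  For unbiasedness write
-- s = √a, so Wᵢ W₀ᵀ = s Vᵢ.  Because W₀ᵀ W₀ = k I (a square integer matrix with
-- W Wᵀ = k I also has Wᵀ W = k I),
--   s² Vᵢ Vⱼᵀ = Wᵢ W₀ᵀ W₀ Wⱼᵀ = k Wᵢ Wⱼᵀ = k s U,
-- where U is the weighing matrix of weight l with Wᵢ Wⱼᵀ = s U.  Finally
-- l s² = k² forces s ∣ k, so k = t s with t² = l, and Vᵢ Vⱼᵀ = t U = √l U.

module FiniteSums where

  open import Defs using (sumFin; scalarI)
  open import Data.Nat as ℕ using (ℕ; zero; suc)
  import Data.Nat.Properties as ℕP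
  open import Data.Fin using (Fin; zero; suc; _≟_)
  open import Data.Integer using (ℤ; +_; _+_; _*_; _-_; 0ℤ)
  import Data.Integer.Properties as ℤP
  open import Data.Integer.Tactic.RingSolver using (solve-∀)
  open import Data.Product using (Σ; _×_; _,_; proj₁; proj₂)
  open import Data.Sum using (inj₁; inj₂)
  open import Relation.Binary.PropositionalEquality
  open import Relation.Nullary using (yes; no)

  sum-cong : ∀ {n} {f g : Fin n → ℤ} → (∀ i → f i ≡ g i) → sumFin f ≡ sumFin g
  sum-cong {zero} _ = refl
  sum-cong {suc n} f≗g = cong₂ _+_ (f≗g zero) (sum-cong (λ i → f≗g (suc i)))

  sum-zeros : ∀ {n} → sumFin {n} (λ _ → 0ℤ) ≡ 0ℤ
  sum-zeros {zero} = refl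
  sum-zeros {suc n} = trans (ℤP.+-identityˡ _) (sum-zeros {n})

  sum-+ : ∀ {n} (f g : Fin n → ℤ) → sumFin (λ i → f i + g i) ≡ sumFin f + sumFin g
  sum-+ {zero} f g = refl
  sum-+ {suc n} f g =
    trans (cong (_+_ (f zero + g zero)) (sum-+ (λ i → f (suc i)) (λ i → g (suc i))))
          (interchange (f zero) (g zero) _ _)
    where
    interchange : ∀ w x y z → (w + x) + (y + z) ≡ (w + y) + (x + z)
    interchange = solve-∀

  sum-- : ∀ {n} (f g : Fin n → ℤ) → sumFin (λ i → f i - g i) ≡ sumFin f - sumFin g
  sum-- {zero} f g = refl
  sum-- {suc n} f g =
    trans (cong (_+_ (f zero - g zero)) (sum-- (λ i → f (suc i)) (λ i → g (suc i))))
          (interchange (f zero) (g zero) _ _)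
    where
    interchange : ∀ w x y z → (w - x) + (y - z) ≡ (w + y) - (x + z)
    interchange = solve-∀

  sum-*ˡ : ∀ {n} c (f : Fin n → ℤ) → sumFin (λ i → c * f i) ≡ c * sumFin f
  sum-*ˡ {zero} c f = sym (ℤP.*-zeroʳ c)
  sum-*ˡ {suc n} c f =
    trans (cong (_+_ (c * f zero)) (sum-*ˡ c (λ i → f (suc i))))
          (sym (ℤP.*-distribˡ-+ c (f zero) _))

  sum-*ʳ : ∀ {n} c (f : Fin n → ℤ) → sumFin (λ i → f i * c) ≡ sumFin f * c
  sum-*ʳ c f =
    trans (sum-cong (λ i → ℤP.*-comm (f i) c)) (trans (sum-*ˡ c f) (ℤP.*-comm c _))

  sum-swap : ∀ {m n} (f : Fin m → Fin n → ℤ) →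
    sumFin (λ i → sumFin (λ j → f i j)) ≡ sumFin (λ j → sumFin (λ i → f i j))
  sum-swap {zero} {n} f = sym (sum-zeros {n})
  sum-swap {suc m} f =
    trans (cong (_+_ (sumFin (f zero))) (sum-swap (λ i → f (suc i))))
          (sym (sum-+ (f zero) (λ j → sumFin (λ i → f (suc i) j))))

  scalarI-suc : ∀ {n} c (i j : Fin n) → scalarI c (suc i) (suc j) ≡ scalarI c i j
  scalarI-suc c i j with i ≟ j
  ... | yes _ = refl
  ... | no _ = refl

  scalarI-sym : ∀ {n} c (i j : Fin n) → scalarI c i j ≡ scalarI c j i
  scalarI-sym c zero zero = refl
  scalarI-sym c zero (suc j) = refl
  scalarI-sym c (suc i) zero = refl
  scalarI-sym c (suc i) (suc j) =
    trans (scalarI-suc c i j) (trans (scalarI-sym c i j) (sym (scalarI-suc c j i)))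

  sum-scalarIʳ : ∀ {n} (g : Fin n → ℤ) c j → sumFin (λ t → g t * scalarI c t j) ≡ g j * c
  sum-scalarIʳ {suc n} g c zero =
    trans (cong (_+_ (g zero * c)) (trans (sum-cong (λ t → ℤP.*-zeroʳ (g (suc t)))) (sum-zeros {n})))
          (ℤP.+-identityʳ _)
  sum-scalarIʳ {suc n} g c (suc j) =
    trans (cong₂ _+_ (ℤP.*-zeroʳ (g zero)) (sum-cong (λ t → cong (g (suc t) *_) (scalarI-suc c t j))))
          (trans (ℤP.+-identityˡ _) (sum-scalarIʳ (λ t → g (suc t)) c j))

  sum-scalarIˡ : ∀ {n} (g : Fin n → ℤ) c i → sumFin (λ t → scalarI c i t * g t) ≡ c * g i
  sum-scalarIˡ g c i =
    trans (sum-cong (λ t → trans (ℤP.*-comm _ (g t)) (cong (g t *_) (scalarI-sym c i t))))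
          (trans (sum-scalarIʳ g c i) (ℤP.*-comm (g i) c))

  Natural : ℤ → Set
  Natural x = Σ ℕ λ m → x ≡ + m

  square-natural : ∀ x → Natural (x * x)
  square-natural (+ zero) = 0 , refl
  square-natural (+ suc m) = _ , refl
  square-natural (Data.Integer.-[1+ m ]) = _ , refl

  square-zero : ∀ x → x * x ≡ 0ℤ → x ≡ 0ℤ
  square-zero x xx≡0 with ℤP.i*j≡0⇒i≡0∨j≡0 x xx≡0
  ... | inj₁ x≡0 = x≡0
  ... | inj₂ x≡0 = x≡0

  sum-natural : ∀ {n} {f : Fin n → ℤ} → (∀ t → Natural (f t)) → Natural (sumFin f)
  sum-natural {zero} _ = 0 , refl
  sum-natural {suc n} nat with nat zero | sum-natural (λ t → nat (suc t))
  ... | m , e | m' , e' = m ℕ.+ m' , cong₂ _+_ e e'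

  natural-+-zero : ∀ {x y} → Natural x → Natural y → x + y ≡ 0ℤ → x ≡ 0ℤ × y ≡ 0ℤ
  natural-+-zero (m , refl) (m' , refl) e =
    cong +_ (ℕP.m+n≡0⇒m≡0 m (ℤP.+-injective e)) , cong +_ (ℕP.m+n≡0⇒n≡0 m (ℤP.+-injective e))

  sum-natural-zero : ∀ {n} {f : Fin n → ℤ} → (∀ t → Natural (f t)) →
    sumFin f ≡ 0ℤ → ∀ t → f t ≡ 0ℤ
  sum-natural-zero nat e zero = proj₁ (natural-+-zero (nat zero) (sum-natural (λ t → nat (suc t))) e)
  sum-natural-zero nat e (suc t) =
    sum-natural-zero (λ t → nat (suc t))
      (proj₂ (natural-+-zero (nat zero) (sum-natural (λ t → nat (suc t))) e)) t

module MatrixAlgebra where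

  open FiniteSums
  open import Defs
  open import Data.Integer using (ℤ; _*_; _-_; 0ℤ)
  import Data.Integer.Properties as ℤP
  open import Data.Integer.Tactic.RingSolver using (solve-∀)
  open import Relation.Binary.PropositionalEquality

  infix 4 _≈M_
  _≈M_ : ∀ {d} → Mat d → Mat d → Set
  A ≈M B = ∀ i j → A i j ≡ B i j

  _−M_ : ∀ {d} → Mat d → Mat d → Mat d
  (A −M B) i j = A i j - B i j

  trace : ∀ {d} → Mat d → ℤ
  trace A = sumFin (λ i → A i i)

  ·-cong : ∀ {d} {A A′ B B′ : Mat d} → A ≈M A′ → B ≈M B′ → A · B ≈M A′ · B′
  ·-cong A≈ B≈ i j = sum-cong (λ t → cong₂ _*_ (A≈ i t) (B≈ t j))

  ·-congˡ : ∀ {d} {A A′ : Mat d} → A ≈M A′ → ∀ B → A · B ≈M A′ · B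
  ·-congˡ A≈ B = ·-cong A≈ (λ _ _ → refl)

  ·-congʳ : ∀ {d} A {B B′ : Mat d} → B ≈M B′ → A · B ≈M A · B′
  ·-congʳ A B≈ = ·-cong {A = A} {A′ = A} (λ _ _ → refl) B≈

  ·-assoc : ∀ {d} (A B C : Mat d) → (A · B) · C ≈M A · (B · C)
  ·-assoc A B C i j = begin
    sumFin (λ t → sumFin (λ u → A i u * B u t) * C t j)
      ≡⟨ sum-cong (λ t → sym (sum-*ʳ (C t j) (λ u → A i u * B u t))) ⟩
    sumFin (λ t → sumFin (λ u → A i u * B u t * C t j))
      ≡⟨ sum-swap (λ t u → A i u * B u t * C t j) ⟩
    sumFin (λ u → sumFin (λ t → A i u * B u t * C t j))
      ≡⟨ sum-cong (λ u → trans (sum-cong (λ t → ℤP.*-assoc (A i u) (B u t) (C t j)))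
                               (sum-*ˡ (A i u) (λ t → B u t * C t j))) ⟩
    sumFin (λ u → A i u * sumFin (λ t → B u t * C t j)) ∎
    where open ≡-Reasoning

  ·-distribʳ-− : ∀ {d} (A B C : Mat d) → (A −M B) · C ≈M (A · C) −M (B · C)
  ·-distribʳ-− A B C i j =
    trans (sum-cong (λ t → distrib (A i t) (B i t) (C t j)))
          (sum-- (λ t → A i t * C t j) (λ t → B i t * C t j))
    where
    distrib : ∀ x y z → (x - y) * z ≡ x * z - y * z
    distrib = solve-∀

  ·-distribˡ-− : ∀ {d} (A B C : Mat d) → A · (B −M C) ≈M (A · B) −M (A · C)
  ·-distribˡ-− A B C i j =
    trans (sum-cong (λ t → distrib (A i t) (B t j) (C t j)))
          (sum-- (λ t → A i t * B t j) (λ t → A i t * C t j))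
    where
    distrib : ∀ x y z → x * (y - z) ≡ x * y - x * z
    distrib = solve-∀

  scalarI-·ˡ : ∀ {d} c (A : Mat d) → scalarI c · A ≈M c ⊙ A
  scalarI-·ˡ c A i j = sum-scalarIˡ (λ t → A t j) c i

  scalarI-·ʳ : ∀ {d} c (A : Mat d) → A · scalarI c ≈M c ⊙ A
  scalarI-·ʳ c A i j = trans (sum-scalarIʳ (A i) c j) (ℤP.*-comm (A i j) c)

  ⊙-·ˡ : ∀ {d} c (A B : Mat d) → (c ⊙ A) · B ≈M c ⊙ (A · B)
  ⊙-·ˡ c A B i j =
    trans (sum-cong (λ t → ℤP.*-assoc c (A i t) (B t j))) (sum-*ˡ c (λ t → A i t * B t j))

  ⊙-·ʳ : ∀ {d} c (A B : Mat d) → A · (c ⊙ B) ≈M c ⊙ (A · B)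
  ⊙-·ʳ c A B i j =
    trans (sum-cong (λ t → swap (A i t) c (B t j))) (sum-*ˡ c (λ t → A i t * B t j))
    where
    swap : ∀ x y z → x * (y * z) ≡ y * (x * z)
    swap = solve-∀

  transpose-cong : ∀ {d} {A B : Mat d} → A ≈M B → transpose A ≈M transpose B
  transpose-cong A≈B i j = A≈B j i

  transpose-· : ∀ {d} (A B : Mat d) → transpose (A · B) ≈M transpose B · transpose A
  transpose-· A B i j = sum-cong (λ t → ℤP.*-comm (A j t) (B t i))

  trace-cong : ∀ {d} {A B : Mat d} → A ≈M B → trace A ≡ trace B
  trace-cong A≈B = sum-cong (λ i → A≈B i i)

  trace-− : ∀ {d} (A B : Mat d) → trace (A −M B) ≡ trace A - trace B
  trace-− A B = sum-- (λ i → A i i) (λ i → B i i)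

  trace-⊙ : ∀ {d} c (A : Mat d) → trace (c ⊙ A) ≡ c * trace A
  trace-⊙ c A = sum-*ˡ c (λ i → A i i)

  trace-comm : ∀ {d} (A B : Mat d) → trace (A · B) ≡ trace (B · A)
  trace-comm A B =
    trans (sum-swap (λ i t → A i t * B t i)) (sum-cong (λ t → sum-cong (λ i → ℤP.*-comm (A i t) (B t i))))

  -- trace (A Aᵀ) is the sum of the squares of the entries of A, so it vanishes
  -- only for A = 0.
  gram-trace-zero : ∀ {d} (A : Mat d) → trace (A · transpose A) ≡ 0ℤ → ∀ i j → A i j ≡ 0ℤ
  gram-trace-zero A tr≡0 i j =
    square-zero (A i j)
      (sum-natural-zero (λ t → square-natural (A i t))
        (sum-natural-zero (λ i → sum-natural (λ t → square-natural (A i t))) tr≡0 i) j)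

module TransposeWeighing where

  -- With
  -- M = Wᵀ W one has M² = c M, so N = M − c I satisfies N Nᵀ = N² = N M − c N = −c N;
  -- hence trace (N Nᵀ) = −c (trace (Wᵀ W) − trace (c I)) = −c (trace (W Wᵀ) − trace (c I)) = 0
  -- and N = 0.  No division by c is needed, so the case c = 0 is included.

  open FiniteSums
  open MatrixAlgebra
  open import Defs
  open import Data.Nat using (ℕ)
  open import Data.Integer using (ℤ; _*_; _-_; 0ℤ)
  import Data.Integer.Properties as ℤP
  open import Relation.Binary.PropositionalEquality

  module _ {d : ℕ} (c : ℤ) (W : Mat d) (gram : W · transpose W ≈M scalarI c) where

    cI M N : Mat d
    cI = scalarI c
    M = transpose W · W
    N = M −M cI

    M²≈cM : M · M ≈M c ⊙ M
    M²≈cM i j = begin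
      (M · M) i j                  ≡⟨ ·-assoc (transpose W) W M i j ⟩
      (transpose W · (W · M)) i j  ≡⟨ ·-congʳ (transpose W) WM≈cW i j ⟩
      (transpose W · (c ⊙ W)) i j  ≡⟨ ⊙-·ʳ c (transpose W) W i j ⟩
      (c ⊙ M) i j                  ∎
      where
      open ≡-Reasoning
      WM≈cW : W · M ≈M c ⊙ W
      WM≈cW p q = trans (sym (·-assoc W (transpose W) W p q))
                        (trans (·-congˡ gram W p q) (scalarI-·ˡ c W p q))

    NM≈0 : ∀ i j → (N · M) i j ≡ 0ℤ
    NM≈0 i j = begin
      (N · M) i j                  ≡⟨ ·-distribʳ-− M cI M i j ⟩
      (M · M) i j - (cI · M) i j   ≡⟨ cong₂ _-_ (M²≈cM i j) (scalarI-·ˡ c M i j) ⟩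
      c * M i j - c * M i j        ≡⟨ ℤP.+-inverseʳ (c * M i j) ⟩
      0ℤ                           ∎
      where open ≡-Reasoning

    N-sym : transpose N ≈M N
    N-sym i j = cong₂ _-_ (sum-cong (λ t → ℤP.*-comm (W t j) (W t i))) (scalarI-sym c j i)

    trace-N : trace N ≡ 0ℤ
    trace-N = begin
      trace N                              ≡⟨ trace-− M cI ⟩
      trace M - trace cI                   ≡⟨ cong (_- trace cI) (trace-comm (transpose W) W) ⟩
      trace (W · transpose W) - trace cI   ≡⟨ cong (_- trace cI) (trace-cong gram) ⟩
      trace cI - trace cI                  ≡⟨ ℤP.+-inverseʳ (trace cI) ⟩
      0ℤ                                   ∎
      where open ≡-Reasoning

    trace-NNᵀ : trace (N · transpose N) ≡ 0ℤ
    trace-NNᵀ = begin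
      trace (N · transpose N)         ≡⟨ trace-cong (·-congʳ N N-sym) ⟩
      trace (N · N)                   ≡⟨ trans (trace-cong (·-distribˡ-− N M cI)) (trace-− (N · M) (N · cI)) ⟩
      trace (N · M) - trace (N · cI)  ≡⟨ cong₂ _-_ (trans (sum-cong (λ i → NM≈0 i i)) (sum-zeros {d}))
                                                   (trans (trace-cong (scalarI-·ʳ c N)) (trace-⊙ c N)) ⟩
      0ℤ - c * trace N                ≡⟨ cong (λ x → 0ℤ - c * x) trace-N ⟩
      0ℤ - c * 0ℤ                     ≡⟨ cong (_-_ 0ℤ) (ℤP.*-zeroʳ c) ⟩
      0ℤ                              ∎
      where open ≡-Reasoning

    gram-transpose : transpose W · W ≈M scalarI c
    gram-transpose i j = ℤP.i-j≡0⇒i≡j _ _ (gram-trace-zero N trace-NNᵀ i j)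

module SquareRoots where

  open import Data.Nat
  open import Data.Nat.Properties
  open import Data.Nat.Divisibility
  open import Data.Nat.GCD
  open import Data.Nat.Coprimality using (Coprime; GCD≡1⇒coprime; coprime-divisor)
  open import Data.Nat.Tactic.RingSolver using (solve-∀)
  open import Data.Product using (Σ; _×_; _,_; proj₂)
  open import Data.Empty using (⊥-elim)
  open import Relation.Binary.Definitions using (tri<; tri≈; tri>)
  open import Relation.Binary.PropositionalEquality

  square-injective : ∀ r s → r * r ≡ s * s → r ≡ s
  square-injective r s e with <-cmp r s
  ... | tri< r<s _ _ = ⊥-elim (<-irrefl e (*-mono-< r<s r<s))
  ... | tri≈ _ r≡s _ = r≡s
  ... | tri> _ _ s<r = ⊥-elim (<-irrefl (sym e) (*-mono-< s<r s<r))

  square-* : ∀ x y → (x * y) * (x * y) ≡ (x * x) * (y * y)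
  square-* = solve-∀

  root-nonZero : ∀ {c} r → 0 < c → r * r ≡ c → NonZero r
  root-nonZero zero 0<c refl = ⊥-elim (<-irrefl refl 0<c)
  root-nonZero (suc r) _ _ = _

  -- m² ∣ n² implies m ∣ n.  Dividing by g = gcd m n leaves coprime m′, n′ with
  -- m′² ∣ n′²; then m′ ∣ n′ forces m′ = 1, i.e. m = g ∣ n.
  square-divides-via-gcd : ∀ {m n} g → GCD m n g → m * m ∣ n * n → m ∣ n
  square-divides-via-gcd {m} zero (GCD.is (_ , 0∣n) _) _ = subst (m ∣_) (sym (0∣⇒≡0 0∣n)) (m ∣0)
  square-divides-via-gcd {m} {n} g@(suc _) gcd@(GCD.is (divides m′ m≡m′g , divides n′ n≡n′g) _) m²∣n² =
    subst (_∣ n) (sym m≡g) (proj₂ (GCD.commonDivisor gcd))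
    where
    m′n′-coprime : Coprime m′ n′
    m′n′-coprime = GCD≡1⇒coprime (GCD-* {m′} {n′} {1} {g}
      (subst₂ (λ x y → GCD x y (1 * g)) m≡m′g n≡n′g (subst (GCD m n) (sym (*-identityˡ g)) gcd)))
    m′²∣n′² : m′ * m′ ∣ n′ * n′
    m′²∣n′² = *-cancelʳ-∣ (g * g) {{m*n≢0 g g}}
      (subst₂ _∣_ (trans (cong (λ x → x * x) m≡m′g) (square-* m′ g))
                  (trans (cong (λ x → x * x) n≡n′g) (square-* n′ g)) m²∣n²)
    m′≡1 : m′ ≡ 1
    m′≡1 = m′n′-coprime (∣-refl , coprime-divisor m′n′-coprime (m*n∣⇒m∣ m′ m′ m′²∣n′²))
    m≡g : m ≡ g
    m≡g = trans m≡m′g (trans (cong (_* g) m′≡1) (*-identityˡ g))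

  square-divides : ∀ m n → m * m ∣ n * n → m ∣ n
  square-divides m n = square-divides-via-gcd (gcd m n) (gcd-GCD m n)

  exact-root : ∀ s k l .{{_ : NonZero s}} → l * (s * s) ≡ k * k →
    Σ ℕ λ t → k ≡ t * s × t * t ≡ l
  exact-root s k l ls²≡k² with square-divides s k (divides l (sym ls²≡k²))
  ... | divides t k≡ts = t , k≡ts , t²≡l
    where
    t²≡l : t * t ≡ l
    t²≡l = *-cancelʳ-≡ (t * t) l (s * s) {{m*n≢0 s s}}
      (trans (sym (square-* t s)) (trans (cong (λ x → x * x) (sym k≡ts)) (sym ls²≡k²)))

module RescaledMatrices where

  open MatrixAlgebra
  open SquareRoots
  open import Defs
  open import Data.Nat as ℕ using (ℕ; NonZero)
  open import Data.Integer using (ℤ; +_; _*_)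
  import Data.Integer.Properties as ℤP
  open import Data.Integer.Tactic.RingSolver using (solve-∀)
  open import Data.Product using (_,_)
  open import Relation.Binary.PropositionalEquality

  scaled-by-root : ∀ {d} {c} (s : ℕ) {M V : Mat d} → s ℕ.* s ≡ c → IsScaledBy c M V → M ≈M (+ s) ⊙ V
  scaled-by-root s s²≡c (r , r²≡c , M≈rV) with square-injective r s (trans r²≡c (sym s²≡c))
  ... | refl = M≈rV

  ⊙-cancel : ∀ {d} s .{{_ : NonZero s}} {A B : Mat d} → (+ s) ⊙ A ≈M (+ s) ⊙ B → A ≈M B
  ⊙-cancel s sA≈sB i j = ℤP.*-cancelˡ-≡ (+ s) _ _ (sA≈sB i j)

  scaled-unique : ∀ {d} {c} {M X Y : Mat d} → 0 ℕ.< c → IsScaledBy c M X → IsScaledBy c M Y → X ≈M Y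
  scaled-unique 0<c (r , r²≡c , M≈rX) M≈Y =
    ⊙-cancel r {{root-nonZero r 0<c r²≡c}} (λ i j → trans (sym (M≈rX i j)) (scaled-by-root r r²≡c M≈Y i j))

  weighing-cong : ∀ {d l} {A B : Mat d} → A ≈M B → IsWeighing d l B → IsWeighing d l A
  weighing-cong A≈B (trits , gram) =
    (λ i j → subst Trit (sym (A≈B i j)) (trits i j)) ,
    (λ i j → trans (·-cong A≈B (transpose-cong A≈B) i j) (gram i j))

  -- The core computation: if W₀ᵀ W₀ = k I, Wᵢ W₀ᵀ = s Vᵢ, Wⱼ W₀ᵀ = s Vⱼ,
  -- Wᵢ Wⱼᵀ = s U and k = t s, then s² Vᵢ Vⱼᵀ = k s U = s² t U, so Vᵢ Vⱼᵀ = t U.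
  conjugate-product : ∀ {d} (k s t : ℕ) .{{_ : NonZero s}} → k ≡ t ℕ.* s →
    (W₀ Wᵢ Wⱼ Vᵢ Vⱼ U : Mat d) → transpose W₀ · W₀ ≈M scalarI (+ k) →
    Wᵢ · transpose W₀ ≈M (+ s) ⊙ Vᵢ → Wⱼ · transpose W₀ ≈M (+ s) ⊙ Vⱼ →
    Wᵢ · transpose Wⱼ ≈M (+ s) ⊙ U → Vᵢ · transpose Vⱼ ≈M (+ t) ⊙ U
  conjugate-product k s t refl W₀ Wᵢ Wⱼ Vᵢ Vⱼ U W₀ᵀW₀≈kI Wᵢ≈ Wⱼ≈ WᵢWⱼᵀ≈ =
    ⊙-cancel s (⊙-cancel s s²VᵢVⱼᵀ≈s²tU)
    where
    S T : ℤ
    S = + s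
    T = + t
    s²VᵢVⱼᵀ≈s²tU : ∀ i j → S * (S * (Vᵢ · transpose Vⱼ) i j) ≡ S * (S * (T * U i j))
    s²VᵢVⱼᵀ≈s²tU i j = begin
      S * (S * (Vᵢ · transpose Vⱼ) i j)
        ≡⟨ sym (trans (⊙-·ˡ S Vᵢ (transpose (S ⊙ Vⱼ)) i j) (cong (S *_) (⊙-·ʳ S Vᵢ (transpose Vⱼ) i j))) ⟩
      ((S ⊙ Vᵢ) · transpose (S ⊙ Vⱼ)) i j
        ≡⟨ sym (·-cong Wᵢ≈ (transpose-cong Wⱼ≈) i j) ⟩
      ((Wᵢ · transpose W₀) · transpose (Wⱼ · transpose W₀)) i j
        ≡⟨ ·-congʳ (Wᵢ · transpose W₀) (transpose-· Wⱼ (transpose W₀)) i j ⟩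
      ((Wᵢ · transpose W₀) · (W₀ · transpose Wⱼ)) i j
        ≡⟨ ·-assoc Wᵢ (transpose W₀) (W₀ · transpose Wⱼ) i j ⟩
      (Wᵢ · (transpose W₀ · (W₀ · transpose Wⱼ))) i j
        ≡⟨ ·-congʳ Wᵢ W₀ᵀW₀Wⱼᵀ i j ⟩
      (Wᵢ · ((+ k) ⊙ transpose Wⱼ)) i j
        ≡⟨ ⊙-·ʳ (+ k) Wᵢ (transpose Wⱼ) i j ⟩
      + k * (Wᵢ · transpose Wⱼ) i j
        ≡⟨ cong₂ _*_ (ℤP.pos-* t s) (WᵢWⱼᵀ≈ i j) ⟩
      T * S * (S * U i j)
        ≡⟨ rearrange S T (U i j) ⟩
      S * (S * (T * U i j)) ∎
      where
      open ≡-Reasoning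
      rearrange : ∀ x y z → y * x * (x * z) ≡ x * (x * (y * z))
      rearrange = solve-∀
      W₀ᵀW₀Wⱼᵀ : transpose W₀ · (W₀ · transpose Wⱼ) ≈M (+ k) ⊙ transpose Wⱼ
      W₀ᵀW₀Wⱼᵀ p q = trans (sym (·-assoc (transpose W₀) W₀ (transpose Wⱼ) p q))
        (trans (·-congˡ W₀ᵀW₀≈kI (transpose Wⱼ) p q) (scalarI-·ˡ (+ k) (transpose Wⱼ) p q))

open import Defs
open import Data.Nat using (ℕ; suc; _*_; _<_; NonZero)
open import Data.Fin using (Fin; zero; suc)
open import Data.Fin.Properties using (suc-injective)
open import Data.Integer using (+_)
open import Data.Product using (_,_; proj₂)
open import Relation.Binary.PropositionalEquality using (_≡_; _≢_; sym; subst)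

open TransposeWeighing using (gram-transpose)
open SquareRoots using (root-nonZero; exact-root)
open MatrixAlgebra using (_≈M_)
open RescaledMatrices

theorem3p1 : (d k l a f : ℕ) → 0 < a → 0 < l → l * a ≡ k * k →
    (W : Fin (suc f) → Mat d) → MutuallyQuasiUnbiased d k l a (suc f) W →
    (V : Fin f → Mat d) →
    (∀ j → IsScaledBy a (W (suc j) · transpose (W zero)) (V j)) →
    MutuallyUnbiased d l f V
theorem3p1 d k l a f 0<a _ la≡k² W (W-weighing , W-quasi) V V-def = V-weighing , V-unbiased
  where
  V-weighing : ∀ j → IsWeighing d l (V j)
  V-weighing j with W-quasi (suc j) zero (λ ())
  ... | U , WⱼW₀ᵀ≈U , U-weighing = weighing-cong (scaled-unique 0<a (V-def j) WⱼW₀ᵀ≈U) U-weighing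

  V-unbiased : ∀ i j → i ≢ j → Unbiased d l (V i) (V j)
  V-unbiased i j i≢j with V-def i | W-quasi (suc i) (suc j) (λ e → i≢j (suc-injective e))
  ... | Vᵢ-def@(s , s²≡a , _) | U , WᵢWⱼᵀ≈U , U-weighing
    with exact-root s k l {{root-nonZero s 0<a s²≡a}} (subst (λ x → l * x ≡ k * k) (sym s²≡a) la≡k²)
  ... | t , k≡ts , t²≡l = U , (t , t²≡l , VᵢVⱼᵀ≈tU) , U-weighing
    where
    instance
      s≢0 : NonZero s
      s≢0 = root-nonZero s 0<a s²≡a
    VᵢVⱼᵀ≈tU : V i · transpose (V j) ≈M (+ t) ⊙ U
    VᵢVⱼᵀ≈tU = conjugate-product k s t k≡ts (W zero) (W (suc i)) (W (suc j)) (V i) (V j) U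
      (gram-transpose (+ k) (W zero) (proj₂ (W-weighing zero)))
      (scaled-by-root s s²≡a Vᵢ-def) (scaled-by-root s s²≡a (V-def j)) (scaled-by-root s s²≡a WᵢWⱼᵀ≈U)
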